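{- Let $n\ge 1$ and let $G=G(K_n)$ be the tree graph of $K_n$. A vertex $T$ of $G$ is a star if and only if $d_G(T,T')\le n-2$ for every vertex $T'$ of $G$.
   Context: $G(K_n)$ is the graph whose vertices are the spanning trees of the complete graph $K_n$ (identified with their edge sets), two spanning trees being adjacent iff their edge sets have symmetric difference of size 2. $d_G$ is the graph distance in $G$. A star is a spanning tree in which one vertex is adjacent to all others. -}

module Defs where

open import Data.Nat using (ℕ; zero; suc; _+_; _≤_; _∸_)
open import Data.Fin using (Fin; _<?_)
open import Data.Fin.Properties using (_≟_)
open import Data.Bool using (Bool; true; false; if_then_else_; _xor_)
open import Data.List using (List; []; _∷_; length; map; concatMap; allFin; head; last)
open import Data.List.Relation.Unary.Unique.Propositional using (Unique)
open import Data.List.Relation.Unary.Linked using (Linked)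
open import Data.Maybe using (just)
open import Data.Nat.ListAction using (sum)
open import Data.Product using (Σ; _×_; ∃; ∃-syntax)
open import Relation.Binary.PropositionalEquality using (_≡_; _≢_)
open import Relation.Nullary.Decidable using (⌊_⌋)

-- An edge set of K_n, given by its adjacency function (symmetric, irreflexive
-- edge sets are exactly the subsets of E(K_n)).
EdgeSet : ℕ → Set
EdgeSet n = Fin n → Fin n → Bool

Adj : ∀ {n} → EdgeSet n → Fin n → Fin n → Set
Adj E u v = E u v ≡ true

IsSymmetric : ∀ {n} → EdgeSet n → Set
IsSymmetric E = ∀ u v → E u v ≡ E v u

IsIrreflexive : ∀ {n} → EdgeSet n → Set
IsIrreflexive E = ∀ u → E u u ≡ false

data Reach {n : ℕ} (E : EdgeSet n) : Fin n → Fin n → Set where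
  reach-refl : ∀ {u} → Reach E u u
  reach-step : ∀ {u w v} → Adj E u w → Reach E w v → Reach E u v

IsConnected : ∀ {n} → EdgeSet n → Set
IsConnected {n} E = ∀ (u v : Fin n) → Reach E u v

IsCycle : ∀ {n} → EdgeSet n → List (Fin n) → Set
IsCycle E vs =
  (3 ≤ length vs) × Unique vs × Linked (Adj E) vs ×
  (∃[ a ] ∃[ b ] (head vs ≡ just a × last vs ≡ just b × Adj E b a))

IsAcyclic : ∀ {n} → EdgeSet n → Set
IsAcyclic {n} E = ∀ (vs : List (Fin n)) → IsCycle E vs → Data.Empty.⊥
  where import Data.Empty

IsSpanningTree : ∀ {n} → EdgeSet n → Set
IsSpanningTree E = IsSymmetric E × IsIrreflexive E × IsConnected E × IsAcyclic E

symDiffSize : ∀ {n} → EdgeSet n → EdgeSet n → ℕ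
symDiffSize {n} E F =
  sum (concatMap (λ i → map (λ j →
        if ⌊ i <? j ⌋ then (if E i j xor F i j then 1 else 0) else 0)
      (allFin n)) (allFin n))

TreeAdj : ∀ {n} → EdgeSet n → EdgeSet n → Set
TreeAdj E F = symDiffSize E F ≡ 2

_≐_ : ∀ {n} → EdgeSet n → EdgeSet n → Set
E ≐ F = ∀ u v → E u v ≡ F u v

data GWalk {n : ℕ} : EdgeSet n → EdgeSet n → ℕ → Set where
  gwalk-nil  : ∀ {T T'} → T ≐ T' → GWalk T T' 0
  gwalk-cons : ∀ {T U V k} → TreeAdj T U → IsSpanningTree U →
               GWalk U V k → GWalk T V (suc k)

DistLe : ∀ {n} → EdgeSet n → EdgeSet n → ℕ → Set
DistLe T T' k = ∃[ m ] (m ≤ k × GWalk T T' m)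

IsStar : ∀ {n} → EdgeSet n → Set
IsStar {n} T = ∃[ c ] (∀ (v : Fin n) → v ≢ c → Adj T c v)

-- Rooting a spanning tree at c by breadth-first search exhibits it as the parent tree
-- {v, p v} of a map p whose rank decreases towards c, and every parent tree has n − 1 edges.
-- If T is the star at c and T′ is any spanning tree with parent map p towards c, move the
-- vertices one at a time from c onto their parent p v: each move exchanges one edge, and
-- neither c nor a child of c in T′ has to move, so T′ is reached in at most n − 2 steps.
-- If T is not a star, its complement is connected (a path of length at most three leads
-- to any fixed vertex, or else T contains a 4-cycle), so it contains a spanning tree T′.
-- Being disjoint from T, the tree T′ differs from T in 2(n − 1) edges, while each step of
-- G(K_n) changes only two.

module Submission where

open import Defs
open import Data.Bool using (Bool; true; false; not; _∧_; _∨_; _xor_; if_then_else_)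
open import Data.Bool.Properties using (∨-comm; ∨-identityʳ; ∧-zeroʳ; xor-same; ¬-not) renaming (_≟_ to _≟ᵇ_)
open import Data.Empty using (⊥-elim)
open import Data.Fin using (Fin; zero; suc; _<?_)
open import Data.Fin.Properties using (_≟_; <-cmp; ¬∀⟶∃¬) renaming (any? to anyᶠ?; all? to allᶠ?; <-asym to <-asymᶠ)
open import Data.List using (List; []; _∷_; map; concatMap; allFin; tabulate; head; last)
open import Data.List.Membership.Propositional using (_∈_; _∉_)
open import Data.List.Membership.Propositional.Properties using (∈-allFin)
open import Data.List.Properties using (map-tabulate)
open import Data.List.Relation.Unary.All as All using (All; []; _∷_)
open import Data.List.Relation.Unary.All.Properties using (¬Any⇒All¬; All¬⇒¬Any)
open import Data.List.Relation.Unary.AllPairs using ([]; _∷_)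
open import Data.List.Relation.Unary.Any as Any using (here; there)
open import Data.List.Relation.Unary.Linked as Linked using (Linked; [-]; _∷_)
open import Data.List.Relation.Unary.Unique.Propositional using (Unique)
open import Data.List.Relation.Unary.Unique.Propositional.Properties using (allFin⁺)
open import Data.Maybe using (just)
open import Data.Maybe.Properties using (just-injective)
open import Data.Nat using (ℕ; zero; suc; _+_; _*_; _∸_; _≤_; _<_; z≤n; s≤s)
open import Data.Nat.Induction using (<-rec)
open import Data.Nat.ListAction using (sum)
open import Data.Nat.ListAction.Properties using (sum-++)
open import Data.Nat.Properties
  using ( +-*-semiring; +-identityʳ; +-assoc; +-suc; *-identityʳ; suc-injective; m+n∸n≡m; m+n≤o⇒m≤o∸n
        ; ≤-refl; ≤-reflexive; ≤-trans; ≤-pred; <-≤-trans; <-trans; <-irrefl; <-asym; n<1+n; ≮⇒≥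
        ; +-mono-≤; +-mono-<; anyUpTo?; module ≤-Reasoning )
open import Algebra.Properties.Semiring.Sum +-*-semiring
  using (sum-syntax; sum-cong-≗; ∑-distrib-+; ∑-comm; sum-replicate-zero; *-distribˡ-sum)
  renaming (sum to ∑)
open import Data.Product using (∃-syntax; _×_; _,_; proj₁; proj₂)
open import Data.Sum using (_⊎_; inj₁; inj₂)
open import Data.Vec.Functional using (Vector)
open import Function using (_∘_; case_of_)
open import Relation.Binary.Definitions using (tri<; tri≈; tri>)
open import Relation.Binary.PropositionalEquality
open import Relation.Binary.PropositionalEquality.Core using (≢-sym)
open import Relation.Nullary using (¬_; Dec; yes; no; does; ¬?; _×-dec_; _⊎-dec_; _→-dec_; contradiction)
open import Relation.Nullary.Decidable using (⌊_⌋; dec-true; dec-false)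
import Relation.Unary as U

-- Iverson brackets and finite sums

does-true⇒ : ∀ {A : Set} (a? : Dec A) → does a? ≡ true → A
does-true⇒ (yes a) _ = a

⟦_⟧ : Bool → ℕ
⟦ b ⟧ = if b then 1 else 0

⟦not⟧+⟦⟧ : ∀ b → ⟦ not b ⟧ + ⟦ b ⟧ ≡ 1
⟦not⟧+⟦⟧ true  = refl
⟦not⟧+⟦⟧ false = refl

⟦⟧≤1 : ∀ b → ⟦ b ⟧ ≤ 1
⟦⟧≤1 true  = ≤-refl
⟦⟧≤1 false = z≤n

⟦∧⟧ : ∀ x y → ⟦ x ∧ y ⟧ ≡ ⟦ x ⟧ * ⟦ y ⟧
⟦∧⟧ true  y = sym (+-identityʳ ⟦ y ⟧)
⟦∧⟧ false y = refl

⟦∨⟧ : ∀ x y → x ∧ y ≡ false → ⟦ x ∨ y ⟧ ≡ ⟦ x ⟧ + ⟦ y ⟧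
⟦∨⟧ true  false _ = refl
⟦∨⟧ false y     _ = refl

xor-exchange : ∀ p r s → p ∧ r ≡ false → s ∧ p ≡ false → s ∧ r ≡ false → (p ∨ s) xor (r ∨ s) ≡ p ∨ r
xor-exchange true  false false _ _ _ = refl
xor-exchange false true  false _ _ _ = refl
xor-exchange false false s     _ _ _ = xor-same s

∑-mono-≤ : ∀ {n} {f g : Vector ℕ n} → (∀ i → f i ≤ g i) → ∑ f ≤ ∑ g
∑-mono-≤ {zero}  f≤g = z≤n
∑-mono-≤ {suc n} f≤g = +-mono-≤ (f≤g zero) (∑-mono-≤ (f≤g ∘ suc))

∑-one : ∀ n → ∑[ i < n ] 1 ≡ n
∑-one zero    = refl
∑-one (suc n) = cong suc (∑-one n)

∑-⟦≟⟧ : ∀ {n} (a : Fin n) → ∑[ i < n ] ⟦ does (i ≟ a) ⟧ ≡ 1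
∑-⟦≟⟧ {suc n} zero    = cong suc (sum-replicate-zero n)
∑-⟦≟⟧ {suc n} (suc a) = ∑-⟦≟⟧ a

∑-⟦≢⟧ : ∀ {n} (a : Fin n) → ∑[ i < n ] ⟦ not (does (i ≟ a)) ⟧ ≡ n ∸ 1
∑-⟦≢⟧ {n} a = trans (sym (m+n∸n≡m (∑ ≢a) 1)) (cong (_∸ 1) ∑≢a+1)
  where
  ≡a ≢a : Vector ℕ n
  ≡a i = ⟦ does (i ≟ a) ⟧
  ≢a i = ⟦ not (does (i ≟ a)) ⟧
  open ≡-Reasoning
  ∑≢a+1 : ∑ ≢a + 1 ≡ n
  ∑≢a+1 = begin
    ∑ ≢a + 1                   ≡⟨ cong (∑ ≢a +_) (∑-⟦≟⟧ a) ⟨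
    ∑ ≢a + ∑ ≡a                ≡⟨ ∑-distrib-+ ≢a ≡a ⟨
    ∑[ i < n ] (≢a i + ≡a i)   ≡⟨ sum-cong-≗ (λ i → ⟦not⟧+⟦⟧ (does (i ≟ a))) ⟩
    ∑[ i < n ] 1               ≡⟨ ∑-one n ⟩
    n                          ∎

∑-≤-∸2 : ∀ {n} {h : Vector ℕ n} {a b} → a ≢ b → (∀ i → h i ≤ 1) → h a ≡ 0 → h b ≡ 0 → ∑ h ≤ n ∸ 2
∑-≤-∸2 {n} {h} {a} {b} a≢b h≤1 ha≡0 hb≡0 = m+n≤o⇒m≤o∸n (∑ h) (begin
  ∑ h + 2                                      ≡⟨ +-assoc (∑ h) 1 1 ⟨
  ∑ h + 1 + 1                                  ≡⟨ cong₂ (λ p q → ∑ h + p + q) (∑-⟦≟⟧ a) (∑-⟦≟⟧ b) ⟨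
  ∑ h + ∑ δa + ∑ δb                            ≡⟨ cong (_+ ∑ δb) (∑-distrib-+ h δa) ⟨
  ∑[ i < n ] (h i + δa i) + ∑ δb               ≡⟨ ∑-distrib-+ (λ i → h i + δa i) δb ⟨
  ∑[ i < n ] (h i + δa i + δb i)               ≤⟨ ∑-mono-≤ (λ i → pointwise (i ≟ a) (i ≟ b)) ⟩
  ∑[ i < n ] 1                                 ≡⟨ ∑-one n ⟩
  n                                            ∎)
  where
  open ≤-Reasoning
  δa δb : Vector ℕ n
  δa i = ⟦ does (i ≟ a) ⟧
  δb i = ⟦ does (i ≟ b) ⟧
  pointwise : ∀ {i} (i≟a : Dec (i ≡ a)) (i≟b : Dec (i ≡ b)) → h i + ⟦ does i≟a ⟧ + ⟦ does i≟b ⟧ ≤ 1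
  pointwise (yes refl) (yes refl) = contradiction refl a≢b
  pointwise (yes refl) (no _)     = ≤-reflexive (cong (λ k → k + 1 + 0) ha≡0)
  pointwise (no _)     (yes refl) = ≤-reflexive (cong (λ k → k + 0 + 1) hb≡0)
  pointwise {i} (no _) (no _)     = ≤-trans (≤-reflexive (trans (+-identityʳ _) (+-identityʳ (h i)))) (h≤1 i)

sum-tabulate : ∀ {n} (f : Vector ℕ n) → sum (tabulate f) ≡ ∑ f
sum-tabulate {zero}  f = refl
sum-tabulate {suc n} f = cong (f zero +_) (sum-tabulate (f ∘ suc))

sum-map-allFin : ∀ {n} (f : Vector ℕ n) → sum (map f (allFin n)) ≡ ∑ f
sum-map-allFin f = trans (cong sum (map-tabulate (λ i → i) f)) (sum-tabulate f)

sum-concatMap : ∀ {A : Set} (f : A → List ℕ) xs → sum (concatMap f xs) ≡ sum (map (sum ∘ f) xs)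
sum-concatMap f []       = refl
sum-concatMap f (x ∷ xs) = trans (sum-++ (f x) (concatMap f xs)) (cong (sum (f x) +_) (sum-concatMap f xs))

∑∑ : ∀ {n} → (Fin n → Fin n → ℕ) → ℕ
∑∑ {n} h = ∑[ i < n ] ∑[ j < n ] h i j

upper : ∀ {n} → (Fin n → Fin n → ℕ) → Fin n → Fin n → ℕ
upper h i j = if ⌊ i <? j ⌋ then h i j else 0

pairSum : ∀ {n} → (Fin n → Fin n → ℕ) → ℕ
pairSum h = ∑∑ (upper h)

symDiffSize≡pairSum : ∀ {n} (E F : EdgeSet n) → symDiffSize E F ≡ pairSum (λ i j → ⟦ E i j xor F i j ⟧)
symDiffSize≡pairSum {n} E F = begin
  sum (concatMap row (allFin n))        ≡⟨ sum-concatMap row (allFin n) ⟩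
  sum (map (sum ∘ row) (allFin n))      ≡⟨ sum-map-allFin (sum ∘ row) ⟩
  ∑[ i < n ] sum (row i)                ≡⟨ sum-cong-≗ (λ i → sum-map-allFin (upper h i)) ⟩
  pairSum h                             ∎
  where
  open ≡-Reasoning
  h : Fin n → Fin n → ℕ
  h i j = ⟦ E i j xor F i j ⟧
  row : Fin n → List ℕ
  row i = map (upper h i) (allFin n)

∑∑-cong : ∀ {n} {g h : Fin n → Fin n → ℕ} → (∀ i j → g i j ≡ h i j) → ∑∑ g ≡ ∑∑ h
∑∑-cong g≡h = sum-cong-≗ (λ i → sum-cong-≗ (g≡h i))

∑∑-mono-≤ : ∀ {n} {g h : Fin n → Fin n → ℕ} → (∀ i j → g i j ≤ h i j) → ∑∑ g ≤ ∑∑ h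
∑∑-mono-≤ g≤h = ∑-mono-≤ (λ i → ∑-mono-≤ (g≤h i))

∑∑-distrib-+ : ∀ {n} (g h : Fin n → Fin n → ℕ) → ∑∑ (λ i j → g i j + h i j) ≡ ∑∑ g + ∑∑ h
∑∑-distrib-+ g h = trans (sum-cong-≗ (λ i → ∑-distrib-+ (g i) (h i))) (∑-distrib-+ (λ i → ∑ (g i)) (λ i → ∑ (h i)))

pairSum-cong : ∀ {n} {g h : Fin n → Fin n → ℕ} → (∀ i j → g i j ≡ h i j) → pairSum g ≡ pairSum h
pairSum-cong g≡h = ∑∑-cong λ i j → cong (if ⌊ i <? j ⌋ then_else 0) (g≡h i j)

pairSum-mono-≤ : ∀ {n} {g h : Fin n → Fin n → ℕ} → (∀ i j → g i j ≤ h i j) → pairSum g ≤ pairSum h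
pairSum-mono-≤ {g = g} {h} g≤h = ∑∑-mono-≤ upper-mono
  where
  upper-mono : ∀ i j → upper g i j ≤ upper h i j
  upper-mono i j with ⌊ i <? j ⌋
  ... | true  = g≤h i j
  ... | false = z≤n

pairSum-distrib-+ : ∀ {n} (g h : Fin n → Fin n → ℕ) → pairSum (λ i j → g i j + h i j) ≡ pairSum g + pairSum h
pairSum-distrib-+ g h = trans (∑∑-cong upper-+) (∑∑-distrib-+ (upper g) (upper h))
  where
  upper-+ : ∀ i j → upper (λ i j → g i j + h i j) i j ≡ upper g i j + upper h i j
  upper-+ i j with ⌊ i <? j ⌋
  ... | true  = refl
  ... | false = refl

pairSum-zero : ∀ {n} {h : Fin n → Fin n → ℕ} → (∀ i j → h i j ≡ 0) → pairSum h ≡ 0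
pairSum-zero {n} h≡0 = trans (pairSum-cong h≡0) (trans (∑∑-cong upper-0) (∑∑-zero n))
  where
  upper-0 : ∀ (i j : Fin n) → upper (λ _ _ → 0) i j ≡ 0
  upper-0 i j with ⌊ i <? j ⌋
  ... | true  = refl
  ... | false = refl
  ∑∑-zero : ∀ n → ∑∑ {n} (λ _ _ → 0) ≡ 0
  ∑∑-zero n = trans (sum-cong-≗ {n} {λ _ → ∑[ j < n ] 0} (λ _ → sum-replicate-zero n)) (sum-replicate-zero n)

∑∑≡pairSum+pairSum : ∀ {n} (h : Fin n → Fin n → ℕ) → (∀ i j → h i j ≡ h j i) → (∀ i → h i i ≡ 0) →
                     ∑∑ h ≡ pairSum h + pairSum h
∑∑≡pairSum+pairSum h h-sym h-diag = begin
  ∑∑ h                                            ≡⟨ ∑∑-cong split ⟩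
  ∑∑ (λ i j → upper h i j + upper h j i)          ≡⟨ ∑∑-distrib-+ (upper h) (λ i j → upper h j i) ⟩
  pairSum h + ∑∑ (λ i j → upper h j i)            ≡⟨ cong (pairSum h +_) (∑-comm (upper h)) ⟨
  pairSum h + pairSum h                           ∎
  where
  open ≡-Reasoning
  split : ∀ i j → h i j ≡ upper h i j + upper h j i
  split i j with i <? j | j <? i
  ... | yes i<j | yes j<i = contradiction j<i (<-asymᶠ i<j)
  ... | yes _   | no _    = sym (+-identityʳ (h i j))
  ... | no _    | yes _   = h-sym i j
  ... | no i≮j  | no j≮i with <-cmp i j
  ...   | tri< i<j _ _  = contradiction i<j i≮j
  ...   | tri≈ _ refl _ = h-diag i
  ...   | tri> _ _ j<i  = contradiction j<i j≮i

double-injective : ∀ {m k} → m + m ≡ k + k → m ≡ k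
double-injective {zero}  {zero}  _ = refl
double-injective {suc m} {suc k} e =
  cong suc (double-injective (suc-injective (trans (sym (+-suc m m)) (trans (suc-injective e) (+-suc k k)))))

pairSum-half : ∀ {n} (h : Fin n → Fin n → ℕ) → (∀ i j → h i j ≡ h j i) → (∀ i → h i i ≡ 0) →
               ∀ {k} → ∑∑ h ≡ k + k → pairSum h ≡ k
pairSum-half h h-sym h-diag e = double-injective (trans (sym (∑∑≡pairSum+pairSum h h-sym h-diag)) e)

-- Edge sets and their symmetric difference

_⊆_ : ∀ {n} → EdgeSet n → EdgeSet n → Set
A ⊆ B = ∀ u v → Adj A u v → Adj B u v

⊆-antisym : ∀ {n} {A B : EdgeSet n} → A ⊆ B → B ⊆ A → A ≐ B
⊆-antisym {A = A} {B} A⊆B B⊆A u v with A u v in eA | B u v in eB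
... | true  | true  = refl
... | false | false = refl
... | true  | false = trans (sym (A⊆B u v eA)) eB
... | false | true  = trans (sym eA) (B⊆A u v eB)

≐-sym : ∀ {n} {A B : EdgeSet n} → A ≐ B → B ≐ A
≐-sym A≐B u v = sym (A≐B u v)

≐-trans : ∀ {n} {A B C : EdgeSet n} → A ≐ B → B ≐ C → A ≐ C
≐-trans A≐B B≐C u v = trans (A≐B u v) (B≐C u v)

edgeCount : ∀ {n} → EdgeSet n → ℕ
edgeCount E = pairSum (λ i j → ⟦ E i j ⟧)

edgeCount-cong : ∀ {n} {A B : EdgeSet n} → A ≐ B → edgeCount A ≡ edgeCount B
edgeCount-cong A≐B = pairSum-cong λ i j → cong ⟦_⟧ (A≐B i j)

edgeCount-half : ∀ {n} {E : EdgeSet n} → IsSymmetric E → IsIrreflexive E →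
                 ∀ {k} → ∑∑ (λ i j → ⟦ E i j ⟧) ≡ k + k → edgeCount E ≡ k
edgeCount-half E-sym E-irr = pairSum-half _ (λ i j → cong ⟦_⟧ (E-sym i j)) (λ i → cong ⟦_⟧ (E-irr i))

arc : ∀ {n} → Fin n → Fin n → Fin n → Fin n → Bool
arc a b i j = does (i ≟ a) ∧ does (j ≟ b)

∑∑-arc : ∀ {n} (a b : Fin n) → ∑∑ (λ i j → ⟦ arc a b i j ⟧) ≡ 1
∑∑-arc {n} a b = begin
  ∑[ i < n ] ∑[ j < n ] ⟦ does (i ≟ a) ∧ does (j ≟ b) ⟧
    ≡⟨ ∑∑-cong (λ i j → ⟦∧⟧ (does (i ≟ a)) (does (j ≟ b))) ⟩
  ∑[ i < n ] ∑[ j < n ] (⟦ does (i ≟ a) ⟧ * ⟦ does (j ≟ b) ⟧)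
    ≡⟨ sum-cong-≗ (λ i → *-distribˡ-sum ⟦ does (i ≟ a) ⟧ (λ j → ⟦ does (j ≟ b) ⟧)) ⟨
  ∑[ i < n ] (⟦ does (i ≟ a) ⟧ * ∑[ j < n ] ⟦ does (j ≟ b) ⟧)
    ≡⟨ sum-cong-≗ (λ i → cong (⟦ does (i ≟ a) ⟧ *_) (∑-⟦≟⟧ b)) ⟩
  ∑[ i < n ] (⟦ does (i ≟ a) ⟧ * 1)
    ≡⟨ sum-cong-≗ (λ i → *-identityʳ ⟦ does (i ≟ a) ⟧) ⟩
  ∑[ i < n ] ⟦ does (i ≟ a) ⟧
    ≡⟨ ∑-⟦≟⟧ a ⟩
  1 ∎
  where open ≡-Reasoning

edge : ∀ {n} → Fin n → Fin n → EdgeSet n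
edge a b i j = arc a b i j ∨ arc a b j i

edge-sym : ∀ {n} (a b : Fin n) → IsSymmetric (edge a b)
edge-sym a b i j = ∨-comm (arc a b i j) (arc a b j i)

edgeCount-edge : ∀ {n} {a b : Fin n} → a ≢ b → edgeCount (edge a b) ≡ 1
edgeCount-edge {a = a} {b} a≢b = edgeCount-half (edge-sym a b) edge-irr (begin
  ∑∑ (λ i j → ⟦ edge a b i j ⟧)
    ≡⟨ ∑∑-cong (λ i j → ⟦∨⟧ (arc a b i j) (arc a b j i) (excl i j)) ⟩
  ∑∑ (λ i j → ⟦ arc a b i j ⟧ + ⟦ arc a b j i ⟧)
    ≡⟨ ∑∑-distrib-+ (λ i j → ⟦ arc a b i j ⟧) (λ i j → ⟦ arc a b j i ⟧) ⟩
  ∑∑ (λ i j → ⟦ arc a b i j ⟧) + ∑∑ (λ i j → ⟦ arc a b j i ⟧)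
    ≡⟨ cong (∑∑ (λ i j → ⟦ arc a b i j ⟧) +_) (∑-comm (λ j i → ⟦ arc a b j i ⟧)) ⟨
  ∑∑ (λ i j → ⟦ arc a b i j ⟧) + ∑∑ (λ i j → ⟦ arc a b i j ⟧)
    ≡⟨ cong (λ k → k + k) (∑∑-arc a b) ⟩
  1 + 1 ∎)
  where
  open ≡-Reasoning
  arc-loop : ∀ i → arc a b i i ≡ false
  arc-loop i with i ≟ a | i ≟ b
  ... | yes refl | yes refl = contradiction refl a≢b
  ... | yes _    | no _     = refl
  ... | no _     | _        = refl
  edge-irr : IsIrreflexive (edge a b)
  edge-irr i rewrite arc-loop i = refl
  excl : ∀ i j → arc a b i j ∧ arc a b j i ≡ false
  excl i j with i ≟ a | j ≟ b | j ≟ a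
  ... | yes refl | yes refl | yes refl = contradiction refl a≢b
  ... | yes _    | yes _    | no _     = refl
  ... | yes _    | no _     | _        = refl
  ... | no _     | _        | _        = refl

symDiffSize-≐ : ∀ {n} {A B : EdgeSet n} → A ≐ B → symDiffSize A B ≡ 0
symDiffSize-≐ {A = A} {B} A≐B = trans (symDiffSize≡pairSum A B) (pairSum-zero λ i j →
  cong ⟦_⟧ (trans (cong (A i j xor_) (sym (A≐B i j))) (xor-same (A i j))))

symDiffSize-triangle : ∀ {n} (A B C : EdgeSet n) → symDiffSize A C ≤ symDiffSize A B + symDiffSize B C
symDiffSize-triangle A B C = begin
  symDiffSize A C
    ≡⟨ symDiffSize≡pairSum A C ⟩
  pairSum (λ i j → ⟦ A i j xor C i j ⟧)
    ≤⟨ pairSum-mono-≤ (λ i j → triangle (A i j) (B i j) (C i j)) ⟩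
  pairSum (λ i j → ⟦ A i j xor B i j ⟧ + ⟦ B i j xor C i j ⟧)
    ≡⟨ pairSum-distrib-+ (λ i j → ⟦ A i j xor B i j ⟧) (λ i j → ⟦ B i j xor C i j ⟧) ⟩
  pairSum (λ i j → ⟦ A i j xor B i j ⟧) + pairSum (λ i j → ⟦ B i j xor C i j ⟧)
    ≡⟨ cong₂ _+_ (symDiffSize≡pairSum A B) (symDiffSize≡pairSum B C) ⟨
  symDiffSize A B + symDiffSize B C ∎
  where
  open ≤-Reasoning
  triangle : ∀ x y z → ⟦ x xor z ⟧ ≤ ⟦ x xor y ⟧ + ⟦ y xor z ⟧
  triangle true  true  z     = ≤-refl
  triangle true  false true  = z≤n
  triangle true  false false = s≤s z≤n
  triangle false true  true  = s≤s z≤n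
  triangle false true  false = z≤n
  triangle false false z     = ≤-refl

symDiffSize-disjoint : ∀ {n} {A B : EdgeSet n} → (∀ u v → Adj B u v → A u v ≡ false) →
                       symDiffSize A B ≡ edgeCount A + edgeCount B
symDiffSize-disjoint {A = A} {B} disjoint =
  trans (symDiffSize≡pairSum A B)
        (trans (pairSum-cong ⟦xor⟧) (pairSum-distrib-+ (λ i j → ⟦ A i j ⟧) (λ i j → ⟦ B i j ⟧)))
  where
  ⟦xor⟧ : ∀ i j → ⟦ A i j xor B i j ⟧ ≡ ⟦ A i j ⟧ + ⟦ B i j ⟧
  ⟦xor⟧ i j with B i j in eB
  ... | true  rewrite disjoint i j eB = refl
  ... | false with A i j
  ...   | true  = refl
  ...   | false = refl

edge-from : ∀ {n} {a b : Fin n} → a ≢ b → ∀ j → edge a b a j ≡ does (j ≟ b)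
edge-from {a = a} {b} a≢b j rewrite dec-true (a ≟ a) refl | dec-false (a ≟ b) a≢b | ∧-zeroʳ (does (j ≟ a)) =
  ∨-identityʳ (does (j ≟ b))

edge-away : ∀ {n} {a b i j : Fin n} → i ≢ a → j ≢ a → edge a b i j ≡ false
edge-away {a = a} {b} {i} {j} i≢a j≢a rewrite dec-false (i ≟ a) i≢a | dec-false (j ≟ a) j≢a = refl

treeAdj-exchange : ∀ {n} {A B : EdgeSet n} {x a b} → IsSymmetric A → IsSymmetric B → x ≢ a → x ≢ b → a ≢ b →
  (∀ i j → i ≢ x → j ≢ x → A i j ≡ B i j) → (∀ j → A x j xor B x j ≡ does (j ≟ a) ∨ does (j ≟ b)) →
  TreeAdj A B
treeAdj-exchange {A = A} {B} {x} {a} {b} A-sym B-sym x≢a x≢b a≢b off-row row = begin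
  symDiffSize A B
    ≡⟨ symDiffSize≡pairSum A B ⟩
  pairSum (λ i j → ⟦ A i j xor B i j ⟧)
    ≡⟨ pairSum-cong A⊕B ⟩
  pairSum (λ i j → ⟦ edge x a i j ⟧ + ⟦ edge x b i j ⟧)
    ≡⟨ pairSum-distrib-+ (λ i j → ⟦ edge x a i j ⟧) (λ i j → ⟦ edge x b i j ⟧) ⟩
  edgeCount (edge x a) + edgeCount (edge x b)
    ≡⟨ cong₂ _+_ (edgeCount-edge x≢a) (edgeCount-edge x≢b) ⟩
  2 ∎
  where
  open ≡-Reasoning
  ⟦row⟧ : ∀ j → ⟦ A x j xor B x j ⟧ ≡ ⟦ edge x a x j ⟧ + ⟦ edge x b x j ⟧
  ⟦row⟧ j = begin
    ⟦ A x j xor B x j ⟧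
      ≡⟨ cong ⟦_⟧ (row j) ⟩
    ⟦ does (j ≟ a) ∨ does (j ≟ b) ⟧
      ≡⟨ ⟦∨⟧ (does (j ≟ a)) (does (j ≟ b)) (dec-false ((j ≟ a) ×-dec (j ≟ b)) λ (j≡a , j≡b) → a≢b (trans (sym j≡a) j≡b)) ⟩
    ⟦ does (j ≟ a) ⟧ + ⟦ does (j ≟ b) ⟧
      ≡⟨ cong₂ (λ p q → ⟦ p ⟧ + ⟦ q ⟧) (edge-from x≢a j) (edge-from x≢b j) ⟨
    ⟦ edge x a x j ⟧ + ⟦ edge x b x j ⟧ ∎
  A⊕B : ∀ i j → ⟦ A i j xor B i j ⟧ ≡ ⟦ edge x a i j ⟧ + ⟦ edge x b i j ⟧
  A⊕B i j = by-cases (i ≟ x) (j ≟ x)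
    where
    by-cases : Dec (i ≡ x) → Dec (j ≡ x) → ⟦ A i j xor B i j ⟧ ≡ ⟦ edge x a i j ⟧ + ⟦ edge x b i j ⟧
    by-cases (yes refl) _          = ⟦row⟧ j
    by-cases (no _)     (yes refl) = trans (cong₂ (λ p q → ⟦ p xor q ⟧) (A-sym i x) (B-sym i x))
                                         (trans (⟦row⟧ i) (cong₂ (λ p q → ⟦ p ⟧ + ⟦ q ⟧) (edge-sym x a x i) (edge-sym x b x i)))
    by-cases (no i≢x)   (no j≢x)   rewrite off-row i j i≢x j≢x | xor-same (B i j) | edge-away {b = a} i≢x j≢x | edge-away {b = b} i≢x j≢x = refl

-- Walks in G(K_n)

symDiffSize-congˡ : ∀ {n} {A A′ : EdgeSet n} (B : EdgeSet n) → A ≐ A′ → symDiffSize A B ≡ symDiffSize A′ B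
symDiffSize-congˡ {A = A} {A′} B A≐A′ =
  trans (symDiffSize≡pairSum A B)
        (trans (pairSum-cong λ i j → cong (λ x → ⟦ x xor B i j ⟧) (A≐A′ i j)) (sym (symDiffSize≡pairSum A′ B)))

gwalk-start : ∀ {n} {A A′ B : EdgeSet n} {m} → A ≐ A′ → GWalk A′ B m → GWalk A B m
gwalk-start A≐A′ (gwalk-nil A′≐B)       = gwalk-nil (≐-trans A≐A′ A′≐B)
gwalk-start A≐A′ (gwalk-cons adj U-tree w) = gwalk-cons (trans (symDiffSize-congˡ _ A≐A′) adj) U-tree w

gwalk-end : ∀ {n} {A B C : EdgeSet n} {m} → GWalk A B m → B ≐ C → GWalk A C m
gwalk-end (gwalk-nil A≐B)          B≐C = gwalk-nil (≐-trans A≐B B≐C)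
gwalk-end (gwalk-cons adj U-tree w) B≐C = gwalk-cons adj U-tree (gwalk-end w B≐C)

gwalk-snoc : ∀ {n} {A B C : EdgeSet n} {m} → GWalk A B m → TreeAdj B C → IsSpanningTree C → GWalk A C (suc m)
gwalk-snoc (gwalk-nil A≐B)            adj C-tree = gwalk-start A≐B (gwalk-cons adj C-tree (gwalk-nil λ _ _ → refl))
gwalk-snoc (gwalk-cons adj′ U-tree w) adj C-tree = gwalk-cons adj′ U-tree (gwalk-snoc w adj C-tree)

gwalk-symDiffSize : ∀ {n} {A B : EdgeSet n} {m} → GWalk A B m → symDiffSize A B ≤ m + m
gwalk-symDiffSize (gwalk-nil A≐B) = ≤-reflexive (symDiffSize-≐ A≐B)
gwalk-symDiffSize {A = A} {B} {suc m} (gwalk-cons {U = U} adj _ w) = begin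
  symDiffSize A B                       ≤⟨ symDiffSize-triangle A U B ⟩
  symDiffSize A U + symDiffSize U B     ≤⟨ +-mono-≤ (≤-reflexive adj) (gwalk-symDiffSize w) ⟩
  2 + (m + m)                           ≡⟨ cong suc (+-suc m m) ⟨
  suc m + suc m                         ∎
  where open ≤-Reasoning

-- Paths and cycles

reach-trans : ∀ {n} {E : EdgeSet n} {u v w} → Reach E u v → Reach E v w → Reach E u w
reach-trans reach-refl          r′ = r′
reach-trans (reach-step adj r) r′ = reach-step adj (reach-trans r r′)

reach-sym : ∀ {n} {E : EdgeSet n} → IsSymmetric E → ∀ {u v} → Reach E u v → Reach E v u
reach-sym E-sym reach-refl = reach-refl
reach-sym E-sym (reach-step {u} {w} adj r) = reach-trans (reach-sym E-sym r) (reach-step (trans (E-sym w u) adj) reach-refl)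

last∈ : ∀ {n} (y : Fin n) ys {z} → last (y ∷ ys) ≡ just z → z ∈ y ∷ ys
last∈ y []        refl   = here refl
last∈ y (y′ ∷ ys) last≡ = there (last∈ y′ ys last≡)

record Path {n} (E : EdgeSet n) (x y : Fin n) : Set where
  field
    vertices : List (Fin n)
    head≡    : head vertices ≡ just x
    last≡    : last vertices ≡ just y
    linked   : Linked (Adj E) vertices
    unique   : Unique vertices

module _ {n} {E : EdgeSet n} where

  suffixFrom-path : ∀ {x y : Fin n} {xs} (x∈xs : x ∈ xs) → last xs ≡ just y →
                    Linked (Adj E) xs → Unique xs → Path E x y
  suffixFrom-path {xs = _ ∷ _} (here refl) last≡ linked unique = record
    { vertices = _ ; head≡ = refl ; last≡ = last≡ ; linked = linked ; unique = unique }
  suffixFrom-path {xs = _ ∷ z ∷ zs} (there x∈xs) last≡ linked unique =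
    suffixFrom-path x∈xs last≡ (Linked.tail linked) (Unique-tail unique)
    where
    Unique-tail : Unique (_ ∷ z ∷ zs) → Unique (z ∷ zs)
    Unique-tail (_ ∷ uws) = uws

  reach⇒path : ∀ {x y} → Reach E x y → Path E x y
  reach⇒path {x} reach-refl = record
    { vertices = x ∷ [] ; head≡ = refl ; last≡ = refl ; linked = [-] ; unique = [] ∷ [] }
  reach⇒path {x} (reach-step adj r) with reach⇒path r
  ... | record { vertices = w ∷ ws ; head≡ = refl ; last≡ = last≡ ; linked = linked ; unique = unique }
    with Any.any? (x ≟_) (w ∷ ws)
  ...   | yes x∈ = suffixFrom-path x∈ last≡ linked unique
  ...   | no x∉  = record
    { vertices = x ∷ w ∷ ws ; head≡ = refl ; last≡ = last≡ ; linked = adj ∷ linked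
    ; unique = ¬Any⇒All¬ (w ∷ ws) x∉ ∷ unique }

  path⇒cycle : ∀ {F : EdgeSet n} {u v} → F ⊆ E → u ≢ v → F v u ≡ false → Adj E u v →
               (P : Path F v u) → IsCycle E (Path.vertices P)
  path⇒cycle _ u≢v _ _ record { vertices = _ ∷ [] ; head≡ = refl ; last≡ = refl } =
    contradiction refl u≢v
  path⇒cycle _ _ Fvu≡false _ record { vertices = _ ∷ _ ∷ [] ; head≡ = refl ; last≡ = refl ; linked = Fxy ∷ [-] } =
    case trans (sym Fxy) Fvu≡false of λ ()
  path⇒cycle F⊆E _ _ Euv record { vertices = _ ∷ _ ∷ _ ∷ _ ; head≡ = head≡ ; last≡ = last≡ ; linked = linked ; unique = unique } =
    s≤s (s≤s (s≤s z≤n)) , unique , Linked.map (F⊆E _ _) linked , _ , _ , head≡ , last≡ , Euv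

-- Parent maps and their trees

Parent : ∀ {n} → Fin n → (Fin n → Fin n) → Fin n → Fin n → Set
Parent c f u v = u ≢ c × v ≡ f u

parent? : ∀ {n} (c : Fin n) f u v → Dec (Parent c f u v)
parent? c f u v = ¬? (u ≟ c) ×-dec (v ≟ f u)

parentTree : ∀ {n} → Fin n → (Fin n → Fin n) → EdgeSet n
parentTree c f u v = does (parent? c f u v ⊎-dec parent? c f v u)

module _ {n} (c : Fin n) (f : Fin n → Fin n) where

  parentTree-intro : ∀ {u v} → Parent c f u v ⊎ Parent c f v u → Adj (parentTree c f) u v
  parentTree-intro = dec-true (parent? c f _ _ ⊎-dec parent? c f _ _)

  parentTree-elim : ∀ u v → Adj (parentTree c f) u v → Parent c f u v ⊎ Parent c f v u
  parentTree-elim u v = does-true⇒ (parent? c f u v ⊎-dec parent? c f v u)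

  parentTree-sym : IsSymmetric (parentTree c f)
  parentTree-sym u v = ∨-comm (does (parent? c f u v)) (does (parent? c f v u))

record ParentMap {n} (c : Fin n) : Set where
  field
    parent : Fin n → Fin n
    rank   : Fin n → ℕ
    rank-< : ∀ v → v ≢ c → rank (parent v) < rank v

  tree : EdgeSet n
  tree = parentTree c parent

  parent-ind : (P : Fin n → Set) → P c → (∀ v → v ≢ c → P (parent v) → P v) → ∀ v → P v
  parent-ind P Pc step v = below (suc (rank v)) v ≤-refl
    where
    below : ∀ b v → rank v < b → P v
    below (suc b) v rank<b with v ≟ c
    ... | yes refl = Pc
    ... | no v≢c   = step v v≢c (below b (parent v) (<-≤-trans (rank-< v v≢c) (≤-pred rank<b)))

  Along : EdgeSet n → Set
  Along E = ∀ v → v ≢ c → Adj E v (parent v)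

module _ {n} {c : Fin n} (pm : ParentMap c) where

  open ParentMap pm

  tree-intro : ∀ {u v} → Parent c parent u v ⊎ Parent c parent v u → Adj tree u v
  tree-intro = parentTree-intro c parent

  tree-elim : ∀ u v → Adj tree u v → Parent c parent u v ⊎ Parent c parent v u
  tree-elim = parentTree-elim c parent

  rank-parent : ∀ {u v} → Parent c parent u v → rank v < rank u
  rank-parent (u≢c , refl) = rank-< _ u≢c

  parent-≢ : ∀ {v} → v ≢ c → parent v ≢ v
  parent-≢ {v} v≢c eq = <-irrefl (cong rank eq) (rank-< v v≢c)

  rank-root-< : ∀ v → v ≢ c → rank c < rank v
  rank-root-< = parent-ind (λ v → v ≢ c → rank c < rank v) (λ c≢c → contradiction refl c≢c) step
    where
    step : ∀ v → v ≢ c → (parent v ≢ c → rank c < rank (parent v)) → v ≢ c → rank c < rank v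
    step v v≢c ih _ with parent v ≟ c
    ... | yes p≡c  = subst (λ w → rank w < rank v) p≡c (rank-< v v≢c)
    ... | no p≢c   = <-trans (ih p≢c) (rank-< v v≢c)

  root-child : ∀ v → v ≢ c → ∃[ w ] (w ≢ c × parent w ≡ c)
  root-child = parent-ind (λ v → v ≢ c → ∃[ w ] (w ≢ c × parent w ≡ c)) (λ c≢c → contradiction refl c≢c) step
    where
    step : ∀ v → v ≢ c → (parent v ≢ c → ∃[ w ] (w ≢ c × parent w ≡ c)) → v ≢ c → ∃[ w ] (w ≢ c × parent w ≡ c)
    step v v≢c ih _ with parent v ≟ c
    ... | yes p≡c = v , v≢c , p≡c
    ... | no p≢c  = ih p≢c

  along⇒reach : ∀ {E} → Along E → ∀ v → Reach E v c
  along⇒reach along = parent-ind (λ v → Reach _ v c) reach-refl (λ v v≢c → reach-step (along v v≢c))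

  tree-along : Along tree
  tree-along v v≢c = tree-intro (inj₁ (v≢c , refl))

  tree-⊆ : ∀ {E} → IsSymmetric E → Along E → tree ⊆ E
  tree-⊆ E-sym along u v Tuv with tree-elim u v Tuv
  ... | inj₁ (u≢c , refl) = along u u≢c
  ... | inj₂ (v≢c , refl) = trans (E-sym u v) (along v v≢c)

  tree-irreflexive : IsIrreflexive tree
  tree-irreflexive v with tree v v in Tvv
  ... | false = refl
  ... | true with tree-elim v v Tvv
  ...   | inj₁ (v≢c , eq) = contradiction (sym eq) (parent-≢ v≢c)
  ...   | inj₂ (v≢c , eq) = contradiction (sym eq) (parent-≢ v≢c)

  tree-connected : IsConnected tree
  tree-connected u v = reach-trans (along⇒reach tree-along u) (reach-sym (parentTree-sym c parent) (along⇒reach tree-along v))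

  -- once a path in the tree steps down to a child it keeps descending
  descending-path : ∀ {y₀ y₁ ys z} → Unique (y₀ ∷ y₁ ∷ ys) → Linked (Adj tree) (y₀ ∷ y₁ ∷ ys) →
                    ¬ Parent c parent y₀ y₁ → last (y₀ ∷ y₁ ∷ ys) ≡ just z → rank y₀ < rank z
  descending-path {y₀} {y₁} {ys} unique (T₀₁ ∷ linked) not-up last≡ with tree-elim y₀ y₁ T₀₁
  ... | inj₁ up = contradiction up not-up
  ... | inj₂ down with ys | unique
  ...   | []      | _ = subst (λ z → rank y₀ < rank z) (just-injective last≡) (rank-parent down)
  ...   | y₂ ∷ _  | ((_ ∷ y₀≢y₂ ∷ _) ∷ unique′) =
    <-trans (rank-parent down) (descending-path unique′ linked (λ up → y₀≢y₂ (trans (proj₂ down) (sym (proj₂ up)))) last≡)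

  -- a path in the tree ending below a vertex t off the path climbs all the way
  ascending-path : ∀ {y₀ y₁ ys z t} → Unique (y₀ ∷ y₁ ∷ ys) → Linked (Adj tree) (y₀ ∷ y₁ ∷ ys) →
                   All (t ≢_) (y₀ ∷ y₁ ∷ ys) → last (y₀ ∷ y₁ ∷ ys) ≡ just z → Parent c parent z t →
                   Parent c parent y₀ y₁ × rank z < rank y₀
  ascending-path {y₀} {y₁} {[]} _ (T₀₁ ∷ _) (t≢y₀ ∷ _) refl z↑t with tree-elim y₀ y₁ T₀₁
  ... | inj₁ up   = up , rank-parent up
  ... | inj₂ down = contradiction (trans (proj₂ z↑t) (sym (proj₂ down))) t≢y₀
  ascending-path {y₀} {y₁} {y₂ ∷ ys} ((_ ∷ y₀≢y₂ ∷ _) ∷ unique) (T₀₁ ∷ linked) (_ ∷ t∉) last≡ z↑t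
    with ascending-path unique linked t∉ last≡ z↑t
  ... | up₁ , rank< with tree-elim y₀ y₁ T₀₁
  ...   | inj₁ up   = up , <-trans rank< (rank-parent up)
  ...   | inj₂ down = contradiction (trans (proj₂ down) (sym (proj₂ up₁))) y₀≢y₂

  tree-acyclic : IsAcyclic tree
  tree-acyclic []           (() , _)
  tree-acyclic (_ ∷ [])     (s≤s () , _)
  tree-acyclic (_ ∷ _ ∷ []) (s≤s (s≤s ()) , _)
  tree-acyclic (a′ ∷ x₁ ∷ x₂ ∷ xs) (_ , unique@(a∉ ∷ unique′) , T₀₁ ∷ linked , a , b , refl , last≡ , Tba)
    with tree-elim b a Tba
  ... | inj₁ b↑a with ascending-path unique′ linked a∉ last≡ b↑a
  ...   | x₁↑x₂ , rank<
    with tree-elim a x₁ T₀₁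
  ...     | inj₁ a↑x₁ = <-irrefl refl (<-trans (<-trans rank< (rank-parent a↑x₁)) (rank-parent b↑a))
  ...     | inj₂ x₁↑a = contradiction (trans (proj₂ x₁↑a) (sym (proj₂ x₁↑x₂))) (All.lookup a∉ (there (here refl)))
  tree-acyclic (a′ ∷ x₁ ∷ x₂ ∷ xs) (_ , unique@(_ ∷ (x₁∉ ∷ _)) , linked , a , b , refl , last≡ , Tba)
      | inj₂ a↑b =
    <-irrefl refl (<-trans (descending-path unique linked a↛x₁ last≡) (rank-parent a↑b))
    where
    a↛x₁ : ¬ Parent c parent a x₁
    a↛x₁ a↑x₁ = All.lookup x₁∉ (last∈ x₂ xs last≡) (trans (proj₂ a↑x₁) (sym (proj₂ a↑b)))

  tree-isSpanningTree : IsSpanningTree tree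
  tree-isSpanningTree = parentTree-sym c parent , tree-irreflexive , tree-connected , tree-acyclic

  tree-edgeCount : edgeCount tree ≡ n ∸ 1
  tree-edgeCount = edgeCount-half (parentTree-sym c parent) tree-irreflexive (begin
    ∑∑ (λ i j → ⟦ tree i j ⟧)
      ≡⟨ ∑∑-cong (λ i j → ⟦∨⟧ (up i j) (up j i) (exclusive i j)) ⟩
    ∑∑ (λ i j → ⟦ up i j ⟧ + ⟦ up j i ⟧)
      ≡⟨ ∑∑-distrib-+ (λ i j → ⟦ up i j ⟧) (λ i j → ⟦ up j i ⟧) ⟩
    ∑∑ (λ i j → ⟦ up i j ⟧) + ∑∑ (λ i j → ⟦ up j i ⟧)
      ≡⟨ cong (∑∑ (λ i j → ⟦ up i j ⟧) +_) (∑-comm (λ j i → ⟦ up j i ⟧)) ⟨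
    ∑∑ (λ i j → ⟦ up i j ⟧) + ∑∑ (λ i j → ⟦ up i j ⟧)
      ≡⟨ cong (λ k → k + k) (trans (sum-cong-≗ ∑-up) (∑-⟦≢⟧ c)) ⟩
    (n ∸ 1) + (n ∸ 1) ∎)
    where
    open ≡-Reasoning
    up : Fin n → Fin n → Bool
    up i j = does (parent? c parent i j)
    exclusive : ∀ i j → up i j ∧ up j i ≡ false
    exclusive i j = dec-false (parent? c parent i j ×-dec parent? c parent j i)
                              (λ (i↑j , j↑i) → <-asym (rank-parent i↑j) (rank-parent j↑i))
    ∑-up : ∀ i → ∑[ j < n ] ⟦ up i j ⟧ ≡ ⟦ not (does (i ≟ c)) ⟧
    ∑-up i = begin
      ∑[ j < n ] ⟦ not (does (i ≟ c)) ∧ does (j ≟ parent i) ⟧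
        ≡⟨ sum-cong-≗ (λ j → ⟦∧⟧ (not (does (i ≟ c))) (does (j ≟ parent i))) ⟩
      ∑[ j < n ] (⟦ not (does (i ≟ c)) ⟧ * ⟦ does (j ≟ parent i) ⟧)
        ≡⟨ *-distribˡ-sum ⟦ not (does (i ≟ c)) ⟧ (λ j → ⟦ does (j ≟ parent i) ⟧) ⟨
      ⟦ not (does (i ≟ c)) ⟧ * ∑[ j < n ] ⟦ does (j ≟ parent i) ⟧
        ≡⟨ cong (⟦ not (does (i ≟ c)) ⟧ *_) (∑-⟦≟⟧ (parent i)) ⟩
      ⟦ not (does (i ≟ c)) ⟧ * 1
        ≡⟨ *-identityʳ _ ⟩
      ⟦ not (does (i ≟ c)) ⟧ ∎

  tree-maximal : ∀ {E} → IsSpanningTree E → Along E → E ≐ tree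
  tree-maximal {E} (E-sym , E-irr , _ , E-acyclic) along = ⊆-antisym E⊆tree (tree-⊆ E-sym along)
    where
    E⊆tree : E ⊆ tree
    E⊆tree u v Euv with tree u v in Tuv
    ... | true  = refl
    ... | false = ⊥-elim (E-acyclic _ (path⇒cycle (tree-⊆ E-sym along) u≢v Tvu≡false Euv (reach⇒path (tree-connected v u))))
      where
      u≢v : u ≢ v
      u≢v refl = case trans (sym Euv) (E-irr u) of λ ()
      Tvu≡false : tree v u ≡ false
      Tvu≡false = trans (parentTree-sym c parent v u) Tuv

-- Breadth-first search

least : ∀ {P : ℕ → Set} → U.Decidable P → ∀ k → P k → ∃[ m ] (P m × (∀ {j} → j < m → ¬ P j))
least {P} P? = <-rec (λ k → P k → ∃[ m ] (P m × (∀ {j} → j < m → ¬ P j))) step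
  where
  step : ∀ k → (∀ {j} → j < k → P j → ∃[ m ] (P m × (∀ {i} → i < m → ¬ P i))) →
         P k → ∃[ m ] (P m × (∀ {j} → j < m → ¬ P j))
  step k smaller Pk with anyUpTo? P? k
  ... | yes (j , j<k , Pj) = smaller j<k Pj
  ... | no none            = k , Pk , λ j<k Pj → none (_ , j<k , Pj)

module BreadthFirst {n} (E : EdgeSet n) (E-connected : IsConnected E) (c : Fin n) where

  Within : ℕ → Fin n → Set
  Within zero    v = v ≡ c
  Within (suc k) v = Within k v ⊎ ∃[ u ] (Adj E v u × Within k u)

  within? : ∀ k v → Dec (Within k v)
  within? zero    v = v ≟ c
  within? (suc k) v = within? k v ⊎-dec anyᶠ? (λ u → (E v u ≟ᵇ true) ×-dec within? k u)

  reach⇒within : ∀ {v} → Reach E v c → ∃[ k ] Within k v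
  reach⇒within reach-refl = 0 , refl
  reach⇒within (reach-step {w = u} adj r) = let k , within = reach⇒within r in suc k , inj₂ (u , adj , within)

  nearest : ∀ v → ∃[ m ] (Within m v × (∀ {j} → j < m → ¬ Within j v))
  nearest v = let k , within = reach⇒within (E-connected v c) in least (λ k → within? k v) k within

  depth : Fin n → ℕ
  depth v = proj₁ (nearest v)

  depth-minimal : ∀ {k v} → Within k v → depth v ≤ k
  depth-minimal {k} {v} within = ≮⇒≥ λ k<depth → proj₂ (proj₂ (nearest v)) k<depth within

  closer-neighbour : ∀ v → v ≢ c → ∃[ u ] (Adj E v u × depth u < depth v)
  closer-neighbour v v≢c with nearest v
  ... | zero  , v≡c , _ = contradiction v≡c v≢c
  ... | suc k , inj₁ within , minimal = contradiction within (minimal ≤-refl)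
  ... | suc k , inj₂ (u , adj , within) , _ = u , adj , s≤s (depth-minimal within)

  towardsRoot : ∀ v → ∃[ u ] (v ≢ c → Adj E v u × depth u < depth v)
  towardsRoot v with v ≟ c
  ... | yes refl = c , λ c≢c → contradiction refl c≢c
  ... | no v≢c   = let u , adj , closer = closer-neighbour v v≢c in u , λ _ → adj , closer

  parentMap : ParentMap c
  parentMap = record
    { parent = λ v → proj₁ (towardsRoot v)
    ; rank   = depth
    ; rank-< = λ v v≢c → proj₂ (proj₂ (towardsRoot v) v≢c) }

  parentMap-along : ParentMap.Along parentMap E
  parentMap-along v v≢c = proj₁ (proj₂ (towardsRoot v) v≢c)

spanningTree-edgeCount : ∀ {n} {E : EdgeSet (suc n)} → IsSpanningTree E → edgeCount E ≡ n
spanningTree-edgeCount E-tree@(_ , _ , E-connected , _) =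
  trans (edgeCount-cong (tree-maximal parentMap E-tree parentMap-along)) (tree-edgeCount parentMap)
  where open BreadthFirst _ E-connected zero

-- Re-hanging vertices, and the distance from a star

module _ {n} (c : Fin n) {g g′ : Fin n → Fin n} where

  parent?-cong : ∀ i j → (i ≢ c → g i ≡ g′ i) → does (parent? c g i j) ≡ does (parent? c g′ i j)
  parent?-cong i j g≈g′ with i ≟ c
  ... | yes _  = refl
  ... | no i≢c rewrite g≈g′ i≢c = refl

  parentTree-cong : (∀ v → v ≢ c → g v ≡ g′ v) → parentTree c g ≐ parentTree c g′
  parentTree-cong g≈g′ i j = cong₂ _∨_ (parent?-cong i j (g≈g′ i)) (parent?-cong j i (g≈g′ j))

  -- re-hanging x from the root onto q, where q is not a child of x
  parentTree-exchange : ∀ {x q} → x ≢ c → q ≢ c → x ≢ q → g x ≡ c → g′ x ≡ q →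
                        (∀ v → v ≢ x → g v ≡ g′ v) → g q ≢ x → TreeAdj (parentTree c g) (parentTree c g′)
  parentTree-exchange {x} {q} x≢c q≢c x≢q gx≡c g′x≡q g≈g′ gq≢x =
    treeAdj-exchange (parentTree-sym c g) (parentTree-sym c g′) x≢c x≢q (λ c≡q → q≢c (sym c≡q)) off-row row
    where
    off-row : ∀ i j → i ≢ x → j ≢ x → parentTree c g i j ≡ parentTree c g′ i j
    off-row i j i≢x j≢x = cong₂ _∨_ (parent?-cong i j (λ _ → g≈g′ i i≢x)) (parent?-cong j i (λ _ → g≈g′ j j≢x))
    leaving : ∀ f j → does (parent? c f x j) ≡ does (j ≟ f x)
    leaving f j rewrite dec-false (x ≟ c) x≢c = refl
    entering : (Fin n → Fin n) → Fin n → Bool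
    entering f j = does (parent? c f j x)
    hanging : ∀ {f t} j → f x ≡ t → parentTree c f x j ≡ does (j ≟ t) ∨ entering f j
    hanging {f} j refl = cong (_∨ entering f j) (leaving f j)
    entering-cong : ∀ j → entering g j ≡ entering g′ j
    entering-cong j with j ≟ x
    ... | no j≢x = parent?-cong j x (λ _ → g≈g′ j j≢x)
    ... | yes refl = begin
      entering g x     ≡⟨ leaving g x ⟩
      does (x ≟ g x)   ≡⟨ cong (does ∘ (x ≟_)) gx≡c ⟩
      does (x ≟ c)     ≡⟨ dec-false (x ≟ c) x≢c ⟩
      false            ≡⟨ dec-false (x ≟ q) x≢q ⟨
      does (x ≟ q)     ≡⟨ cong (does ∘ (x ≟_)) g′x≡q ⟨
      does (x ≟ g′ x)  ≡⟨ leaving g′ x ⟨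
      entering g′ x    ∎
      where open ≡-Reasoning
    row : ∀ j → parentTree c g x j xor parentTree c g′ x j ≡ does (j ≟ c) ∨ does (j ≟ q)
    row j = begin
      parentTree c g x j xor parentTree c g′ x j
        ≡⟨ cong₂ _xor_ (hanging j gx≡c) (hanging j g′x≡q) ⟩
      (does (j ≟ c) ∨ entering g j) xor (does (j ≟ q) ∨ entering g′ j)
        ≡⟨ cong (λ e → (does (j ≟ c) ∨ entering g j) xor (does (j ≟ q) ∨ e)) (entering-cong j) ⟨
      (does (j ≟ c) ∨ entering g j) xor (does (j ≟ q) ∨ entering g j)
        ≡⟨ xor-exchange (does (j ≟ c)) (does (j ≟ q)) (entering g j) c≢q j↑x⇒j≢c j↑x⇒j≢q ⟩
      does (j ≟ c) ∨ does (j ≟ q) ∎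
      where
      open ≡-Reasoning
      c≢q : does (j ≟ c) ∧ does (j ≟ q) ≡ false
      c≢q = dec-false ((j ≟ c) ×-dec (j ≟ q)) (λ (j≡c , j≡q) → q≢c (trans (sym j≡q) j≡c))
      j↑x⇒j≢c : entering g j ∧ does (j ≟ c) ≡ false
      j↑x⇒j≢c = dec-false (parent? c g j x ×-dec (j ≟ c)) (λ ((j≢c , _) , j≡c) → j≢c j≡c)
      j↑x⇒j≢q : entering g j ∧ does (j ≟ q) ≡ false
      j↑x⇒j≢q = dec-false (parent? c g j x ×-dec (j ≟ q)) (λ ((_ , x≡gj) , j≡q) → gq≢x (trans (cong g (sym j≡q)) (sym x≡gj)))

module Rehanging {n} {c : Fin n} (pm : ParentMap c) where

  open ParentMap pm
  open import Data.List.Membership.DecPropositional (_≟_ {n}) using (_∈?_)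

  hangFrom : List (Fin n) → Fin n → Fin n
  hangFrom xs v = if does (v ∈? xs) then parent v else c

  hangFrom-∈ : ∀ {v xs} → v ∈ xs → hangFrom xs v ≡ parent v
  hangFrom-∈ {v} {xs} v∈xs rewrite dec-true (v ∈? xs) v∈xs = refl

  hangFrom-∉ : ∀ {v xs} → v ∉ xs → hangFrom xs v ≡ c
  hangFrom-∉ {v} {xs} v∉xs rewrite dec-false (v ∈? xs) v∉xs = refl

  hangFrom-∷ : ∀ {x v} xs → v ≢ x → hangFrom xs v ≡ hangFrom (x ∷ xs) v
  hangFrom-∷ {x} {v} xs v≢x rewrite dec-false (v ≟ x) v≢x = refl

  hangFrom-parentMap : List (Fin n) → ParentMap c
  hangFrom-parentMap xs = record { parent = hangFrom xs ; rank = rank ; rank-< = rank-<′ }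
    where
    rank-<′ : ∀ v → v ≢ c → rank (hangFrom xs v) < rank v
    rank-<′ v v≢c with does (v ∈? xs)
    ... | true  = rank-< v v≢c
    ... | false = rank-root-< pm v v≢c

  moves : Fin n → ℕ
  moves x = ⟦ not (does (x ≟ c)) ∧ not (does (parent x ≟ c)) ⟧

  rehang : ∀ xs → Unique xs →
           GWalk (parentTree c (hangFrom [])) (parentTree c (hangFrom xs)) (sum (map moves xs))
  rehang []       _                = gwalk-nil λ _ _ → refl
  rehang (x ∷ xs) (x∉xs ∷ unique) with x ≟ c | parent x ≟ c
  ... | yes x≡c | _ =
    gwalk-end (rehang xs unique) (parentTree-cong c λ v v≢c → hangFrom-∷ xs λ v≡x → v≢c (trans v≡x x≡c))
  ... | no x≢c | yes px≡c =
    gwalk-end (rehang xs unique) (parentTree-cong c λ v v≢c → same v)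
    where
    same : ∀ v → hangFrom xs v ≡ hangFrom (x ∷ xs) v
    same v with v ≟ x
    ... | yes refl = trans (hangFrom-∉ (All¬⇒¬Any x∉xs)) (sym px≡c)
    ... | no _     = refl
  ... | no x≢c | no px≢c =
    gwalk-snoc (rehang xs unique)
      (parentTree-exchange c x≢c px≢c (λ x≡px → parent-≢ pm x≢c (sym x≡px))
        (hangFrom-∉ (All¬⇒¬Any x∉xs)) (hangFrom-∈ {xs = x ∷ xs} (here refl)) (λ v → hangFrom-∷ xs) not-child)
      (tree-isSpanningTree (hangFrom-parentMap (x ∷ xs)))
    where
    not-child : hangFrom xs (parent x) ≢ x
    not-child with does (parent x ∈? xs)
    ... | true  = λ ppx≡x → <-asym (rank-parent pm (px≢c , sym ppx≡x)) (rank-< x x≢c)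
    ... | false = λ c≡x → x≢c (sym c≡x)

starMap : ∀ {n} (c : Fin n) → ParentMap c
starMap c = record { parent = λ _ → c ; rank = λ v → ⟦ not (does (v ≟ c)) ⟧ ; rank-< = rank-< }
  where
  rank-< : ∀ v → v ≢ c → ⟦ not (does (c ≟ c)) ⟧ < ⟦ not (does (v ≟ c)) ⟧
  rank-< v v≢c rewrite dec-true (c ≟ c) refl | dec-false (v ≟ c) v≢c = s≤s z≤n

star≐starMap : ∀ {n} {T : EdgeSet n} {c} → IsSpanningTree T → (∀ v → v ≢ c → Adj T c v) → T ≐ ParentMap.tree (starMap c)
star≐starMap {T = T} {c} T-tree star = tree-maximal (starMap c) T-tree λ v v≢c → trans (proj₁ T-tree v c) (star v v≢c)

other-than : ∀ {n} (c : Fin (suc (suc n))) → ∃[ v ] v ≢ c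
other-than zero    = suc zero , λ ()
other-than (suc _) = zero , λ ()

star-near : ∀ {n} {T T′ : EdgeSet (suc (suc n))} → IsSpanningTree T → IsStar T → IsSpanningTree T′ → DistLe T T′ n
star-near {n} {T} {T′} T-tree (c , star) T′-tree@(_ , _ , T′-connected , _) =
  sum (map moves (allFin _)) , moves≤n ,
  gwalk-start (star≐starMap T-tree star) (gwalk-end (rehang (allFin _) (allFin⁺ _)) hangFrom-all≐T′)
  where
  open BreadthFirst T′ T′-connected c
  open Rehanging parentMap
  open ParentMap parentMap using (parent)
  hangFrom-all≐T′ : parentTree c (hangFrom (allFin _)) ≐ T′
  hangFrom-all≐T′ = ≐-trans (parentTree-cong c λ v _ → hangFrom-∈ (∈-allFin v))
                            (≐-sym (tree-maximal parentMap T′-tree parentMap-along))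
  moves≤n : sum (map moves (allFin _)) ≤ n
  moves≤n with root-child parentMap (proj₁ (other-than c)) (proj₂ (other-than c))
  ... | w , w≢c , pw≡c = subst (_≤ n) (sym (sum-map-allFin moves))
      (∑-≤-∸2 (λ c≡w → w≢c (sym c≡w)) (λ x → ⟦⟧≤1 _) moves-c moves-w)
    where
    moves-c : moves c ≡ 0
    moves-c rewrite dec-true (c ≟ c) refl = refl
    moves-w : moves w ≡ 0
    moves-w rewrite pw≡c | dec-true (c ≟ c) refl = cong ⟦_⟧ (∧-zeroʳ _)

-- Spanning trees in the complement of a non-star

complement : ∀ {n} → EdgeSet n → EdgeSet n
complement E u v = not (E u v) ∧ not (does (u ≟ v))

complement-sym : ∀ {n} {E : EdgeSet n} → IsSymmetric E → IsSymmetric (complement E)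
complement-sym E-sym u v = cong₂ (λ p q → not p ∧ not q) (E-sym u v) (does-≟-sym u v)
  where
  does-≟-sym : ∀ u v → does (u ≟ v) ≡ does (v ≟ u)
  does-≟-sym u v with u ≟ v
  ... | yes refl = sym (dec-true (u ≟ u) refl)
  ... | no u≢v   = sym (dec-false (v ≟ u) λ v≡u → u≢v (sym v≡u))

complement-intro : ∀ {n} {E : EdgeSet n} {u v} → u ≢ v → E u v ≡ false → Adj (complement E) u v
complement-intro {u = u} {v} u≢v Euv≡false rewrite Euv≡false | dec-false (u ≟ v) u≢v = refl

complement-elim : ∀ {n} {E : EdgeSet n} {u v} → Adj (complement E) u v → E u v ≡ false
complement-elim {E = E} {u} {v} Ēuv with E u v
... | false = refl

NonStar : ∀ {n} → EdgeSet n → Set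
NonStar {n} T = ∀ d → ∃[ v ] (v ≢ d × T d v ≡ false)

module _ {n} {T : EdgeSet n} (T-tree : IsSpanningTree T) (nonStar : NonStar T) where

  private
    T-sym = proj₁ T-tree
    T-irr = proj₁ (proj₂ T-tree)
    T-acyclic = proj₂ (proj₂ (proj₂ T-tree))

  complement-step : ∀ {u w b} → u ≢ w → T u w ≡ false → Reach (complement T) w b → Reach (complement T) u b
  complement-step u≢w Tuw≡false = reach-step (complement-intro {E = T} u≢w Tuw≡false)

  T-flip : ∀ {x y b} → T x y ≡ b → T y x ≡ b
  T-flip {x} {y} = trans (T-sym y x)

  nonadj-reaches : ∀ {w a} → w ≢ a → T a w ≡ false → Reach (complement T) w a
  nonadj-reaches w≢a Taw = complement-step w≢a (T-flip Taw) reach-refl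

  adj-≢ : ∀ {x y} → T x y ≡ true → x ≢ y
  adj-≢ {x} Txy refl = case trans (sym Txy) (T-irr x) of λ ()

  adj-≢-nonadj : ∀ {x y y′} → T x y ≡ true → T x y′ ≡ false → y ≢ y′
  adj-≢-nonadj Txy Txy′ refl = case trans (sym Txy) Txy′ of λ ()

  -- the only obstruction to reaching a within three steps would be the 4-cycle a z w₀ v
  complement-reaches : ∀ a v → Reach (complement T) v a
  complement-reaches a v with v ≟ a | T a v in Tav
  ... | yes refl | _     = reach-refl
  ... | no v≢a   | false = nonadj-reaches v≢a Tav
  ... | no v≢a   | true  with nonStar v
  ...   | z , z≢v , Tvz with T a z in Taz
  ...     | false = complement-step (≢-sym z≢v) Tvz (nonadj-reaches (≢-sym (adj-≢-nonadj (T-flip Tav) Tvz)) Taz)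
  ...     | true  with nonStar a
  ...       | w₀ , w₀≢a , Taw₀ with T z w₀ in Tzw₀ | T v w₀ in Tvw₀
  ...         | false | _     = complement-step (≢-sym z≢v) Tvz (complement-step (adj-≢-nonadj Taz Taw₀) Tzw₀ (nonadj-reaches w₀≢a Taw₀))
  ...         | true  | false = complement-step (adj-≢-nonadj Tav Taw₀) Tvw₀ (nonadj-reaches w₀≢a Taw₀)
  ...         | true  | true  = ⊥-elim (T-acyclic (a ∷ z ∷ w₀ ∷ v ∷ []) cycle)
    where
    distinct : Unique (a ∷ z ∷ w₀ ∷ v ∷ [])
    distinct = (adj-≢ Taz ∷ ≢-sym w₀≢a ∷ ≢-sym v≢a ∷ [])
             ∷ (adj-≢-nonadj Taz Taw₀ ∷ z≢v ∷ [])
             ∷ (≢-sym (adj-≢-nonadj Tav Taw₀) ∷ [])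
             ∷ [] ∷ []
    cycle : IsCycle T (a ∷ z ∷ w₀ ∷ v ∷ [])
    cycle = s≤s (s≤s (s≤s z≤n)) , distinct , Taz ∷ Tzw₀ ∷ T-flip Tvw₀ ∷ [-] , a , v , refl , refl , T-flip Tav

  complement-connected : IsConnected (complement T)
  complement-connected u v = complement-reaches v u

nonStar-far : ∀ {m} {T : EdgeSet (suc m)} → IsSpanningTree T → NonStar T →
              ∃[ T′ ] (IsSpanningTree T′ × ¬ DistLe T T′ (m ∸ 1))
nonStar-far {zero} T-tree nonStar with nonStar zero
... | zero , 0≢0 , _ = contradiction refl 0≢0
nonStar-far {suc m} {T} T-tree nonStar = T′ , tree-isSpanningTree parentMap , far
  where
  open BreadthFirst (complement T) (complement-connected T-tree nonStar) zero
  T′ = ParentMap.tree parentMap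
  symDiffSize≡ : symDiffSize T T′ ≡ suc m + suc m
  symDiffSize≡ = begin
    symDiffSize T T′
      ≡⟨ symDiffSize-disjoint (λ u v T′uv → complement-elim {E = T}
           (tree-⊆ parentMap (complement-sym (proj₁ T-tree)) parentMap-along u v T′uv)) ⟩
    edgeCount T + edgeCount T′
      ≡⟨ cong₂ _+_ (spanningTree-edgeCount T-tree) (spanningTree-edgeCount (tree-isSpanningTree parentMap)) ⟩
    suc m + suc m ∎
    where open ≡-Reasoning
  far : ¬ DistLe T T′ m
  far (k , k≤m , walk) = <-irrefl refl (begin-strict
    symDiffSize T T′   ≤⟨ gwalk-symDiffSize walk ⟩
    k + k              ≤⟨ +-mono-≤ k≤m k≤m ⟩
    m + m              <⟨ +-mono-< (n<1+n m) (n<1+n m) ⟩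
    suc m + suc m      ≡⟨ symDiffSize≡ ⟨
    symDiffSize T T′   ∎)
    where open ≤-Reasoning

isStar? : ∀ {n} (T : EdgeSet n) → Dec (IsStar T)
isStar? T = anyᶠ? λ c → allᶠ? λ v → ¬? (v ≟ c) →-dec (T c v ≟ᵇ true)

¬IsStar⇒NonStar : ∀ {n} {T : EdgeSet n} → ¬ IsStar T → NonStar T
¬IsStar⇒NonStar {n} {T} ¬star d with ¬∀⟶∃¬ n _ (λ v → ¬? (v ≟ d) →-dec (T d v ≟ᵇ true)) (λ star → ¬star (d , star))
... | v , ¬[v≢d→Tdv] = v , (λ v≡d → ¬[v≢d→Tdv] λ v≢d → contradiction v≡d v≢d) , ¬-not (λ Tdv → ¬[v≢d→Tdv] λ _ → Tdv)

one-vertex-≐ : ∀ {T T′ : EdgeSet 1} → IsIrreflexive T → IsIrreflexive T′ → T ≐ T′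
one-vertex-≐ T-irr T′-irr zero zero = trans (T-irr zero) (sym (T′-irr zero))

claim3 : ∀ (n : ℕ) → 1 ≤ n → ∀ (T : EdgeSet n) → IsSpanningTree T →
           (IsStar T → ∀ (T' : EdgeSet n) → IsSpanningTree T' → DistLe T T' (n ∸ 2))
         × ((∀ (T' : EdgeSet n) → IsSpanningTree T' → DistLe T T' (n ∸ 2)) → IsStar T)
claim3 (suc zero) _ T (_ , T-irr , _) =
  (λ _ T′ (_ , T′-irr , _) → 0 , z≤n , gwalk-nil (one-vertex-≐ T-irr T′-irr)) ,
  (λ _ → zero , λ { zero 0≢0 → contradiction refl 0≢0 })
claim3 (suc (suc n)) _ T T-tree = (λ star T′ T′-tree → star-near T-tree star T′-tree) , near⇒star
  where
  near⇒star : (∀ T′ → IsSpanningTree T′ → DistLe T T′ n) → IsStar T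
  near⇒star near with isStar? T
  ... | yes star = star
  ... | no ¬star with nonStar-far T-tree (¬IsStar⇒NonStar ¬star)
  ...   | T′ , T′-tree , far = contradiction (near T′ T′-tree) far
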